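{- Let $b$ be a queue behavior with a sequential witness $\mu$. (1) If $d\in\mathrm{Deq}(b)$ and $e\in\mathrm{Enq}(b)$ satisfy $\mu(d)=e$, and $b'$ is obtained from $b$ by removing both $d$ and $e$, then the restriction of $\mu$ to $\mathrm{Deq}(b')$ is a sequential witness for $b'$. (2) If $d\in\mathrm{Deq}(b)$ returns $\mathtt{NULL}$ and $b'$ is obtained from $b$ by removing $d$, then the restriction of $\mu$ to $\mathrm{Deq}(b')$ is a sequential witness for $b'$.
   Context: A queue event is a tuple $(u,m,d_{in},d_{out})$ with a globally unique identifier $u$ and method $m\in\{\mathtt{enq},\mathtt{deq}\}$; an enqueue event carries a value $x\in\mathbb{N}$ and a dequeue event returns a value $x\in\mathbb{N}\cup\{\mathtt{NULL}\}$. A queue behavior is a finite duplicate-free sequence of queue events (not necessarily legal). For a behavior $b$: $\mathrm{Enq}(b)$, $\mathrm{Deq}(b)$ are its enqueue and dequeue events, $\mathrm{Val}(b,e)$ the value enqueued or returned by $e$, and $e\prec_b e'$ means $e$ occurs before $e'$ in $b$. A sequential witness for $b$ is a total map $\mu:\mathrm{Deq}(b)\to\mathrm{Enq}(b)\cup\{\bot\}$ such that: (i) $\mu(d)=e$ implies $\mathrm{Val}(b,d)=\mathrm{Val}(b,e)$; (ii) $\mu(d)=\bot$ iff $\mathrm{Val}(b,d)=\mathtt{NULL}$; (iii) $\mu(d)=\mu(d')\neq\bot$ implies $d=d'$; (iv) $\mu(d)=e$ implies $e\prec_b d$; (v) if $e\prec_b\mu(d')$ then there is $d$ with $\mu(d)=e$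 and $d\prec_b d'$; (vi) $\mu(d)=\bot$ implies $|\{e\in\mathrm{Enq}(b)\mid e\prec_b d\}|=|\{d'\in\mathrm{Deq}(b)\mid d'\prec_b d,\ \mu(d')\neq\bot\}|$. -}

module Defs where

open import Data.Nat using (ℕ; zero; suc)
open import Data.Bool using (Bool; true; false; if_then_else_)
open import Data.Maybe using (Maybe; just; nothing)
open import Data.List using (List; []; _∷_; _++_; map)
open import Data.List.Membership.Propositional using (_∈_)
open import Data.List.Relation.Unary.Unique.Propositional using (Unique)
open import Data.Product using (Σ; ∃; ∃-syntax; _×_; _,_)
open import Relation.Binary.PropositionalEquality using (_≡_; _≢_; refl; cong; cong₂)
open import Relation.Nullary using (Dec; yes; no; ¬_)
open import Relation.Nullary.Decidable using (map′)
import Data.Nat.Properties as ℕₚ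
import Data.Maybe.Properties as Mₚ

-- Methods together with their data: an enqueue carries a value x ∈ ℕ,
-- a dequeue returns a value in ℕ ∪ {NULL} (NULL = nothing).
data Op : Set where
  enq : ℕ → Op
  deq : Maybe ℕ → Op

-- A queue event (u, m, d_in, d_out): identifier u and the operation.
record Event : Set where
  constructor event
  field
    uid : ℕ
    op  : Op
open Event public

val : Event → Maybe ℕ
val (event _ (enq x)) = just x
val (event _ (deq r)) = r

data IsEnq : Event → Set where
  isEnq : ∀ {u x} → IsEnq (event u (enq x))

data IsDeq : Event → Set where
  isDeq : ∀ {u r} → IsDeq (event u (deq r))

isEnqᵇ : Event → Bool
isEnqᵇ (event _ (enq _)) = true
isEnqᵇ (event _ (deq _)) = false

enq-inj : ∀ {x y} → enq x ≡ enq y → x ≡ y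
enq-inj refl = refl

deq-inj : ∀ {x y} → deq x ≡ deq y → x ≡ y
deq-inj refl = refl

_≟ₒ_ : (a b : Op) → Dec (a ≡ b)
enq x ≟ₒ enq y = map′ (cong enq) enq-inj (x ℕₚ.≟ y)
enq x ≟ₒ deq y = no (λ ())
deq x ≟ₒ enq y = no (λ ())
deq x ≟ₒ deq y = map′ (cong deq) deq-inj (Mₚ.≡-dec ℕₚ._≟_ x y)

_≟ₑ_ : (a b : Event) → Dec (a ≡ b)
event u o ≟ₑ event v p with u ℕₚ.≟ v | o ≟ₒ p
... | yes refl | yes refl = yes refl
... | no u≢v   | _        = no (λ { refl → u≢v refl })
... | yes _    | no o≢p   = no (λ { refl → o≢p refl })

Behavior : Set
Behavior = List Event

WellFormed : Behavior → Set
WellFormed b = Unique (map uid b)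

-- removing an event (every occurrence; there is at most one) from a behavior
remove : Event → Behavior → Behavior
remove e [] = []
remove e (x ∷ xs) with x ≟ₑ e
... | yes _ = remove e xs
... | no  _ = x ∷ remove e xs

_≺[_]_ : Event → Behavior → Event → Set
e ≺[ b ] e' = ∃[ xs ] ∃[ ys ] ∃[ zs ] (b ≡ xs ++ e ∷ ys ++ e' ∷ zs)

countEnq : List Event → ℕ
countEnq [] = 0
countEnq (x ∷ xs) = if isEnqᵇ x then suc (countEnq xs) else countEnq xs

countMatchedDeq : (Event → Maybe Event) → List Event → ℕ
countMatchedDeq μ [] = 0
countMatchedDeq μ (x ∷ xs) with isEnqᵇ x | μ x
... | false | just _  = suc (countMatchedDeq μ xs)
... | _     | _       = countMatchedDeq μ xs

-- Sequential witness.  μ is a function on events; only its values on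
-- Deq(b) matter (⊥ = nothing), so "restriction of μ to Deq(b')" is μ itself.
record SeqWitness (b : Behavior) (μ : Event → Maybe Event) : Set where
  field
    codom : ∀ d e → d ∈ b → IsDeq d → μ d ≡ just e → e ∈ b × IsEnq e
    w-val : ∀ d e → d ∈ b → IsDeq d → μ d ≡ just e → val d ≡ val e
    w-null⇒ : ∀ d → d ∈ b → IsDeq d → μ d ≡ nothing → val d ≡ nothing
    w-⇒null : ∀ d → d ∈ b → IsDeq d → val d ≡ nothing → μ d ≡ nothing
    w-inj : ∀ d d' e → d ∈ b → IsDeq d → d' ∈ b → IsDeq d' →
            μ d ≡ just e → μ d' ≡ just e → d ≡ d'
    w-order : ∀ d e → d ∈ b → IsDeq d → μ d ≡ just e → e ≺[ b ] d
    w-fifo : ∀ e d' e' → e ∈ b → IsEnq e → d' ∈ b → IsDeq d' →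
             μ d' ≡ just e' → e ≺[ b ] e' →
             ∃[ d ] (d ∈ b × IsDeq d × μ d ≡ just e × d ≺[ b ] d')
    -- (vi): for d at position |xs| in b, the events preceding d are those of xs
    w-empty : ∀ d → d ∈ b → IsDeq d → μ d ≡ nothing →
              ∀ xs ys → b ≡ xs ++ d ∷ ys →
              countEnq xs ≡ countMatchedDeq μ xs

module Submission where

-- Every clause of a sequential witness except (vi) concerns only events that survive together
-- with their μ-partners, so it is inherited by any sub-behaviour closed under μ and μ⁻¹:
-- deleting events keeps the relative order of the others.  Clause (vi) asks the prefix before a
-- NULL dequeue to be balanced (as many enqueues as matched dequeues).  Deleting an unmatched
-- dequeue changes neither count; deleting a matched pair (d, e) lowers both counts by one when d
-- lies in the prefix, and does nothing when neither does.  The case e in the prefix, d after it,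
-- is impossible: μ maps the matched dequeues of the prefix injectively into its enqueues other
-- than e, so the prefix would have fewer matched dequeues than enqueues.

open import Defs
open import Data.Bool using (true; false; T?)
open import Data.Empty using (⊥-elim)
open import Data.List using (List; []; _∷_; _++_; [_]; length; filter; filterᵇ)
open import Data.List.Membership.DecPropositional _≟ₑ_ using (_∈?_)
open import Data.List.Membership.Propositional using (_∈_; _∉_)
open import Data.List.Membership.Propositional.Properties using (∈-++⁺ˡ; ∈-++⁺ʳ; ∈-filter⁺; ∈-filter⁻)
open import Data.List.Properties using (filter-++; filter-accept; filter-reject; filter-all; filter-notAll; ∷-injective)
open import Data.List.Relation.Binary.Subset.Propositional using (_⊆_)
import Data.List.Relation.Unary.All as All
import Data.List.Relation.Unary.All.Properties as All
import Data.List.Relation.Unary.Any as Any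
open import Data.List.Relation.Unary.Any using (here; there)
open import Data.List.Relation.Unary.AllPairs using ([]; _∷_)
open import Data.List.Relation.Unary.Unique.Propositional using (Unique)
import Data.List.Relation.Unary.Unique.Propositional.Properties as UP
open import Data.Maybe using (Maybe; just; nothing)
open import Data.Maybe.Properties using (just-injective)
open import Data.Nat using (ℕ; suc; _+_; _≤_; _<_; z≤n)
open import Data.Nat.Properties using (suc-injective; <-irrefl; +-commutativeSemigroup; module ≤-Reasoning)
open import Algebra.Properties.CommutativeSemigroup +-commutativeSemigroup using (x∙yz≈y∙xz)
open import Data.Product using (∃-syntax; _×_; _,_; proj₁; proj₂)
open import Data.Sum using (_⊎_; inj₁; inj₂)
open import Data.Unit using (tt)
open import Function using (_∘_; case_of_)
open import Function.Bundles using (_⇔_; mk⇔; Equivalence)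
open import Relation.Binary.Definitions using (DecidableEquality)
open import Relation.Binary.PropositionalEquality
  using (_≡_; _≢_; refl; sym; trans; cong; subst; subst₂; ≢-sym; module ≡-Reasoning)
open import Relation.Nullary using (Dec; yes; no; ¬?)
open import Relation.Unary using (Pred; Decidable)
open import Relation.Unary.Properties using (_∩?_)

module _ {a} {A : Set a} where

  Unique-++⁻ˡ : ∀ xs {ys : List A} → Unique (xs ++ ys) → Unique xs
  Unique-++⁻ˡ []       _        = []
  Unique-++⁻ˡ (x ∷ xs) (x∉ ∷ u) = All.++⁻ˡ xs x∉ ∷ Unique-++⁻ˡ xs u

  module _ {p q} {P : Pred A p} {Q : Pred A q} (P? : Decidable P) (Q? : Decidable Q) where

    filter-filter : ∀ xs → filter Q? (filter P? xs) ≡ filter (P? ∩? Q?) xs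
    filter-filter []       = refl
    filter-filter (x ∷ xs) with P? x
    ... | no  _ = filter-filter xs
    ... | yes _ with Q? x
    ...   | yes _ = cong (x ∷_) (filter-filter xs)
    ...   | no  _ = filter-filter xs

  module _ {p} {P : Pred A p} (P? : Decidable P) where

    filter-split : ∀ xs {ys′ z zs′} → filter P? xs ≡ ys′ ++ z ∷ zs′ →
                   ∃[ ys ] ∃[ zs ] (xs ≡ ys ++ z ∷ zs × filter P? ys ≡ ys′ × filter P? zs ≡ zs′)
    filter-split []       {[]}     ()
    filter-split []       {_ ∷ _}  ()
    filter-split (x ∷ xs) eq with P? x
    ... | no ¬px with ys , zs , refl , refl , refl ← filter-split xs eq
      = x ∷ ys , zs , refl , filter-reject P? ¬px , refl
    filter-split (x ∷ xs) {[]} refl | yes _ = [] , xs , refl , refl , refl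
    filter-split (x ∷ xs) {_ ∷ ys′} eq | yes px with refl , eq′ ← ∷-injective eq
      with ys , zs , refl , refl , refl ← filter-split xs eq′
      = x ∷ ys , zs , refl , filter-accept P? px , refl

  module _ (_≟_ : DecidableEquality A) where
    open ≤-Reasoning

    mutual
      Unique-length-mono-⊆ : ∀ {xs ys : List A} → Unique xs → xs ⊆ ys → length xs ≤ length ys
      Unique-length-mono-⊆ {[]}    _          _   = z≤n
      Unique-length-mono-⊆ {_ ∷ _} (x∉xs ∷ u) sub =
        Unique-length-strictMono-⊆ u (sub ∘ there) (sub (here refl)) (All.All¬⇒¬Any x∉xs)

      Unique-length-strictMono-⊆ : ∀ {xs ys : List A} {z} → Unique xs → xs ⊆ ys →
                                   z ∈ ys → z ∉ xs → length xs < length ys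
      Unique-length-strictMono-⊆ {xs} {ys} {z} u sub z∈ys z∉xs = begin-strict
        length xs                        ≤⟨ Unique-length-mono-⊆ u xs⊆ys-z ⟩
        length (filter (¬? ∘ (z ≟_)) ys) <⟨ filter-notAll (¬? ∘ (z ≟_)) ys (Any.map (λ z≡y z≢y → z≢y z≡y) z∈ys) ⟩
        length ys                        ∎
        where
        xs⊆ys-z : xs ⊆ filter (¬? ∘ (z ≟_)) ys
        xs⊆ys-z {x} x∈xs = ∈-filter⁺ (¬? ∘ (z ≟_)) (sub x∈xs) (λ { refl → z∉xs x∈xs })

enq≢deq : ∀ {e d} → IsEnq e → IsDeq d → e ≢ d
enq≢deq isEnq isDeq ()

_≢?_ : (x r : Event) → Dec (x ≢ r)
x ≢? r = ¬? (x ≟ₑ r)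

remove≡filter : ∀ r xs → remove r xs ≡ filter (_≢? r) xs
remove≡filter r []       = refl
remove≡filter r (x ∷ xs) with x ≟ₑ r
... | yes _ = remove≡filter r xs
... | no  _ = cong (x ∷_) (remove≡filter r xs)

remove-∉ : ∀ {r} xs → r ∉ xs → remove r xs ≡ xs
remove-∉ {r} xs r∉xs =
  trans (remove≡filter r xs) (filter-all (_≢? r) (All.map ≢-sym (All.¬Any⇒All¬ xs r∉xs)))

∈-remove⁺ : ∀ {r x} xs → x ∈ xs → x ≢ r → x ∈ remove r xs
∈-remove⁺ {r} xs x∈xs x≢r = subst (_ ∈_) (sym (remove≡filter r xs)) (∈-filter⁺ (_≢? r) x∈xs x≢r)

Unique-remove : ∀ {r} xs → Unique xs → Unique (remove r xs)
Unique-remove {r} xs u = subst Unique (sym (remove≡filter r xs)) (UP.filter⁺ (_≢? r) u)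

remove-remove≡filter : ∀ d e xs → remove e (remove d xs) ≡ filter ((_≢? d) ∩? (_≢? e)) xs
remove-remove≡filter d e xs = begin
  remove e (remove d xs)                   ≡⟨ remove≡filter e (remove d xs) ⟩
  filter (_≢? e) (remove d xs)             ≡⟨ cong (filter (_≢? e)) (remove≡filter d xs) ⟩
  filter (_≢? e) (filter (_≢? d) xs)       ≡⟨ filter-filter (_≢? d) (_≢? e) xs ⟩
  filter ((_≢? d) ∩? (_≢? e)) xs           ∎
  where open ≡-Reasoning

≺-∈ʳ : ∀ {x y b} → x ≺[ b ] y → y ∈ b
≺-∈ʳ (xs , ys , _ , refl) = ∈-++⁺ʳ xs (there (∈-++⁺ʳ ys (here refl)))

≺-∷⁻ : ∀ {x y w b} → x ≺[ w ∷ b ] y → x ≡ w × y ∈ b ⊎ x ≺[ b ] y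
≺-∷⁻ ([]     , ys , _  , refl) = inj₁ (refl , ∈-++⁺ʳ ys (here refl))
≺-∷⁻ (_ ∷ xs , ys , zs , refl) = inj₂ (xs , ys , zs , refl)

∈-prefix : ∀ {b xs ys : Behavior} {x} → b ≡ xs ++ ys → x ∈ xs → x ∈ b
∈-prefix refl = ∈-++⁺ˡ

≺-prefix : ∀ {b} xs {ys x y} → Unique b → b ≡ xs ++ ys → x ≺[ b ] y → y ∈ xs → x ∈ xs
≺-prefix (w ∷ xs) (w∉ ∷ u) refl x≺y y∈ with ≺-∷⁻ x≺y | y∈
... | inj₁ (refl , _) | _          = here refl
... | inj₂ x≺y′       | here refl  = ⊥-elim (All.lookup w∉ (≺-∈ʳ x≺y′) refl)
... | inj₂ x≺y′       | there y∈xs = there (≺-prefix xs u refl x≺y′ y∈xs)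

module _ {p} {P : Pred Event p} (P? : Decidable P) where

  ≺-filter⁺ : ∀ {x y b} → P x → P y → x ≺[ b ] y → x ≺[ filter P? b ] y
  ≺-filter⁺ {x} {y} px py (xs , ys , zs , refl) = filter P? xs , filter P? ys , filter P? zs , (begin
    filter P? (xs ++ x ∷ ys ++ y ∷ zs)
      ≡⟨ filter-++ P? xs _ ⟩
    filter P? xs ++ filter P? (x ∷ ys ++ y ∷ zs)
      ≡⟨ cong (filter P? xs ++_) (filter-accept P? px) ⟩
    filter P? xs ++ x ∷ filter P? (ys ++ y ∷ zs)
      ≡⟨ cong (λ l → filter P? xs ++ x ∷ l) (filter-++ P? ys _) ⟩
    filter P? xs ++ x ∷ filter P? ys ++ filter P? (y ∷ zs)
      ≡⟨ cong (λ l → filter P? xs ++ x ∷ filter P? ys ++ l) (filter-accept P? py) ⟩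
    filter P? xs ++ x ∷ filter P? ys ++ y ∷ filter P? zs
      ∎)
    where open ≡-Reasoning

  ≺-filter⁻ : ∀ {x y b} → x ≺[ filter P? b ] y → x ≺[ b ] y
  ≺-filter⁻ {b = b} (_ , _ , _ , eq)
    with xs , rest , refl , _ , eq′ ← filter-split P? b eq
    with ys , zs , refl , _ , _ ← filter-split P? rest eq′
    = xs , ys , zs , refl

Additive : (List Event → ℕ) → Set
Additive c = ∀ x xs → c (x ∷ xs) ≡ c [ x ] + c xs

countEnq-additive : Additive countEnq
countEnq-additive x xs with isEnqᵇ x
... | true  = refl
... | false = refl

countMatchedDeq-additive : ∀ μ → Additive (countMatchedDeq μ)
countMatchedDeq-additive μ x xs with isEnqᵇ x | μ x
... | true  | _       = refl
... | false | just _  = refl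
... | false | nothing = refl

countMatchedDeq-unmatched : ∀ μ {d} → IsDeq d → μ d ≡ nothing → countMatchedDeq μ [ d ] ≡ 0
countMatchedDeq-unmatched _ isDeq μd≡nothing rewrite μd≡nothing = refl

countMatchedDeq-matched : ∀ μ {d e} → IsDeq d → μ d ≡ just e → countMatchedDeq μ [ d ] ≡ 1
countMatchedDeq-matched _ isDeq μd≡just rewrite μd≡just = refl

module _ (c : List Event → ℕ) (c-additive : Additive c) where
  open ≡-Reasoning

  remove-weightless : ∀ {r} → c [ r ] ≡ 0 → ∀ xs → c (remove r xs) ≡ c xs
  remove-weightless     _      []       = refl
  remove-weightless {r} c[r]≡0 (x ∷ xs) with x ≟ₑ r
  ... | yes refl = begin
    c (remove r xs)  ≡⟨ remove-weightless c[r]≡0 xs ⟩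
    c xs             ≡⟨ cong (_+ c xs) (sym c[r]≡0) ⟩
    c [ r ] + c xs   ≡⟨ c-additive r xs ⟨
    c (r ∷ xs)       ∎
  ... | no _ = begin
    c (x ∷ remove r xs)       ≡⟨ c-additive x (remove r xs) ⟩
    c [ x ] + c (remove r xs) ≡⟨ cong (c [ x ] +_) (remove-weightless c[r]≡0 xs) ⟩
    c [ x ] + c xs            ≡⟨ c-additive x xs ⟨
    c (x ∷ xs)                ∎

  remove-member-weight : ∀ {r} xs → Unique xs → r ∈ xs → c [ r ] + c (remove r xs) ≡ c xs
  remove-member-weight {r} (x ∷ xs) (x∉xs ∷ u) r∈ with x ≟ₑ r | r∈
  ... | yes refl | _ = begin
    c [ x ] + c (remove x xs)  ≡⟨ cong (c [ x ] +_) (cong c (remove-∉ xs (All.All¬⇒¬Any x∉xs))) ⟩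
    c [ x ] + c xs             ≡⟨ c-additive x xs ⟨
    c (x ∷ xs)                 ∎
  ... | no x≢r | here refl   = ⊥-elim (x≢r refl)
  ... | no _   | there r∈xs = begin
    c [ r ] + c (x ∷ remove r xs)         ≡⟨ cong (c [ r ] +_) (c-additive x (remove r xs)) ⟩
    c [ r ] + (c [ x ] + c (remove r xs)) ≡⟨ x∙yz≈y∙xz (c [ r ]) (c [ x ]) _ ⟩
    c [ x ] + (c [ r ] + c (remove r xs)) ≡⟨ cong (c [ x ] +_) (remove-member-weight xs u r∈xs) ⟩
    c [ x ] + c xs                        ≡⟨ c-additive x xs ⟨
    c (x ∷ xs)                            ∎

Balanced : (Event → Maybe Event) → List Event → Set
Balanced μ xs = countEnq xs ≡ countMatchedDeq μ xs

module _ {μ : Event → Maybe Event} where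
  open ≡-Reasoning

  Balanced-remove-unmatched : ∀ {r} xs → IsDeq r → μ r ≡ nothing →
                              Balanced μ xs → Balanced μ (remove r xs)
  Balanced-remove-unmatched {r} xs r-deq@isDeq μr≡nothing bal = begin
    countEnq (remove r xs)
      ≡⟨ remove-weightless countEnq countEnq-additive refl xs ⟩
    countEnq xs
      ≡⟨ bal ⟩
    countMatchedDeq μ xs
      ≡⟨ remove-weightless (countMatchedDeq μ) (countMatchedDeq-additive μ)
           (countMatchedDeq-unmatched μ r-deq μr≡nothing) xs ⟨
    countMatchedDeq μ (remove r xs)
      ∎

  Balanced-remove-pair : ∀ {d e e′} xs → Unique xs → d ∈ xs → e ∈ xs → IsDeq d → IsEnq e →
                         μ d ≡ just e′ → Balanced μ xs → Balanced μ (remove e (remove d xs))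
  Balanced-remove-pair {d} {e} xs u d∈xs e∈xs d-deq@isDeq e-enq@isEnq μd bal = suc-injective (begin
    suc (countEnq (remove e X))
      ≡⟨ remove-member-weight countEnq countEnq-additive X (Unique-remove xs u) e∈X ⟩
    countEnq X
      ≡⟨ remove-weightless countEnq countEnq-additive refl xs ⟩
    countEnq xs
      ≡⟨ bal ⟩
    countMatchedDeq μ xs
      ≡⟨ remove-member-weight (countMatchedDeq μ) (countMatchedDeq-additive μ) xs u d∈xs ⟨
    countMatchedDeq μ [ d ] + countMatchedDeq μ X
      ≡⟨ cong (_+ countMatchedDeq μ X) (countMatchedDeq-matched μ d-deq μd) ⟩
    suc (countMatchedDeq μ X)
      ≡⟨ cong suc (remove-weightless (countMatchedDeq μ) (countMatchedDeq-additive μ) refl X) ⟨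
    suc (countMatchedDeq μ (remove e X))
      ∎)
    where
    X : List Event
    X = remove d xs

    e∈X : e ∈ X
    e∈X = ∈-remove⁺ xs e∈xs (enq≢deq e-enq d-deq)

matchedImages : (Event → Maybe Event) → List Event → List Event
matchedImages μ []                         = []
matchedImages μ (event _ (enq _) ∷ xs)     = matchedImages μ xs
matchedImages μ (d@(event _ (deq _)) ∷ xs) with μ d
... | just e  = e ∷ matchedImages μ xs
... | nothing = matchedImages μ xs

InjectiveOnDeq : (Event → Maybe Event) → List Event → Set
InjectiveOnDeq μ xs = ∀ {d d′ e} → d ∈ xs → IsDeq d → d′ ∈ xs → IsDeq d′ →
                      μ d ≡ just e → μ d′ ≡ just e → d ≡ d′

module _ (μ : Event → Maybe Event) where

  length-matchedImages : ∀ xs → length (matchedImages μ xs) ≡ countMatchedDeq μ xs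
  length-matchedImages []                         = refl
  length-matchedImages (event _ (enq _) ∷ xs)     = length-matchedImages xs
  length-matchedImages (d@(event _ (deq _)) ∷ xs) with μ d
  ... | just _  = cong suc (length-matchedImages xs)
  ... | nothing = length-matchedImages xs

  ∈-matchedImages⁻ : ∀ {e} xs → e ∈ matchedImages μ xs → ∃[ d ] (d ∈ xs × IsDeq d × μ d ≡ just e)
  ∈-matchedImages⁻ (event _ (enq _) ∷ xs) e∈
    with d , d∈ , d-deq , μd ← ∈-matchedImages⁻ xs e∈ = d , there d∈ , d-deq , μd
  ∈-matchedImages⁻ (d@(event _ (deq _)) ∷ xs) e∈ with μ d in μd
  ... | just _ with e∈
  ...   | here refl = d , here refl , isDeq , μd
  ...   | there e∈′ with d′ , d′∈ , d′-deq , μd′ ← ∈-matchedImages⁻ xs e∈′ = d′ , there d′∈ , d′-deq , μd′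
  ∈-matchedImages⁻ (d@(event _ (deq _)) ∷ xs) e∈ | nothing
    with d′ , d′∈ , d′-deq , μd′ ← ∈-matchedImages⁻ xs e∈ = d′ , there d′∈ , d′-deq , μd′

  matchedImages-Unique : ∀ xs → Unique xs → InjectiveOnDeq μ xs → Unique (matchedImages μ xs)
  matchedImages-Unique []                         _          _   = []
  matchedImages-Unique (event _ (enq _) ∷ xs)     (_ ∷ u)    inj =
    matchedImages-Unique xs u (λ d∈ dd d′∈ → inj (there d∈) dd (there d′∈))
  matchedImages-Unique (d@(event _ (deq _)) ∷ xs) (d∉xs ∷ u) inj with μ d in μd
  ... | just e  = All.¬Any⇒All¬ _ e∉ ∷ matchedImages-Unique xs u (λ d∈ dd d′∈ → inj (there d∈) dd (there d′∈))
    where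
    e∉ : e ∉ matchedImages μ xs
    e∉ e∈ with d′ , d′∈ , d′-deq , μd′ ← ∈-matchedImages⁻ xs e∈ =
      All.All¬⇒¬Any d∉xs (subst (_∈ xs) (sym (inj (here refl) isDeq (there d′∈) d′-deq μd μd′)) d′∈)
  ... | nothing = matchedImages-Unique xs u (λ d∈ dd d′∈ → inj (there d∈) dd (there d′∈))

enqueues : List Event → List Event
enqueues = filterᵇ isEnqᵇ

length-enqueues : ∀ xs → length (enqueues xs) ≡ countEnq xs
length-enqueues []       = refl
length-enqueues (x ∷ xs) with isEnqᵇ x
... | true  = cong suc (length-enqueues xs)
... | false = length-enqueues xs

∈-enqueues⁺ : ∀ {e xs} → e ∈ xs → IsEnq e → e ∈ enqueues xs
∈-enqueues⁺ e∈xs isEnq = ∈-filter⁺ (T? ∘ isEnqᵇ) e∈xs tt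

unmatched-enqueue-deficit : ∀ {b μ} → Unique b → SeqWitness b μ → ∀ xs {ys e} → b ≡ xs ++ ys →
                            e ∈ xs → IsEnq e → (∀ {d} → d ∈ xs → IsDeq d → μ d ≢ just e) →
                            countMatchedDeq μ xs < countEnq xs
unmatched-enqueue-deficit {μ = μ} u W xs b≡ e∈xs e-enq unmatched =
  subst₂ _<_ (length-matchedImages μ xs) (length-enqueues xs)
    (Unique-length-strictMono-⊆ _≟ₑ_ images-unique images⊆enqueues (∈-enqueues⁺ e∈xs e-enq) e∉images)
  where
  open SeqWitness W

  ∈b : ∀ {x} → x ∈ xs → x ∈ _
  ∈b = ∈-prefix b≡

  images-unique : Unique (matchedImages μ xs)
  images-unique = matchedImages-Unique μ xs (Unique-++⁻ˡ xs (subst Unique b≡ u))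
    (λ d∈ dd d′∈ dd′ → w-inj _ _ _ (∈b d∈) dd (∈b d′∈) dd′)

  images⊆enqueues : matchedImages μ xs ⊆ enqueues xs
  images⊆enqueues e′∈ with d , d∈ , d-deq , μd ← ∈-matchedImages⁻ μ xs e′∈ =
    ∈-enqueues⁺ (≺-prefix xs u b≡ (w-order d _ (∈b d∈) d-deq μd) d∈) (proj₂ (codom d _ (∈b d∈) d-deq μd))

  e∉images : _ ∉ matchedImages μ xs
  e∉images e∈ with d , d∈ , d-deq , μd ← ∈-matchedImages⁻ μ xs e∈ = unmatched d∈ d-deq μd

filter-witness : ∀ {b μ p} {P : Pred Event p} (P? : Decidable P) → SeqWitness b μ →
                 (∀ {d e} → d ∈ b → IsDeq d → μ d ≡ just e → P d ⇔ P e) →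
                 (∀ xs {ys} → b ≡ xs ++ ys → Balanced μ xs → Balanced μ (filter P? xs)) →
                 SeqWitness (filter P? b) μ
filter-witness {b} {μ} {P = P} P? W closed balanced = record
  { codom   = λ d e d∈ dd μd → let d∈b , pd = kept⁻ d∈ ; e∈b , ee = codom d e d∈b dd μd
                               in ∈-filter⁺ P? e∈b (to (closed d∈b dd μd) pd) , ee
  ; w-val   = λ d e d∈ → w-val d e (kept d∈)
  ; w-null⇒ = λ d d∈ → w-null⇒ d (kept d∈)
  ; w-⇒null = λ d d∈ → w-⇒null d (kept d∈)
  ; w-inj   = λ d d′ e d∈ dd d′∈ → w-inj d d′ e (kept d∈) dd (kept d′∈)
  ; w-order = λ d e d∈ dd μd → let d∈b , pd = kept⁻ d∈
                               in ≺-filter⁺ P? (to (closed d∈b dd μd) pd) pd (w-order d e d∈b dd μd)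
  ; w-fifo  = fifo
  ; w-empty = empty
  }
  where
  open SeqWitness W
  open Equivalence

  kept⁻ : ∀ {x} → x ∈ filter P? b → x ∈ b × P x
  kept⁻ = ∈-filter⁻ P? {xs = b}

  kept : ∀ {x} → x ∈ filter P? b → x ∈ b
  kept = proj₁ ∘ kept⁻

  fifo : ∀ e d′ e′ → e ∈ filter P? b → IsEnq e → d′ ∈ filter P? b → IsDeq d′ →
         μ d′ ≡ just e′ → e ≺[ filter P? b ] e′ →
         ∃[ d ] (d ∈ filter P? b × IsDeq d × μ d ≡ just e × d ≺[ filter P? b ] d′)
  fifo e d′ e′ e∈ ee d′∈ dd′ μd′ e≺e′
    with d , d∈b , dd , μd , d≺d′ ← w-fifo e d′ e′ (kept e∈) ee (kept d′∈) dd′ μd′ (≺-filter⁻ P? e≺e′)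
    = d , ∈-filter⁺ P? d∈b pd , dd , μd , ≺-filter⁺ P? pd (proj₂ (kept⁻ d′∈)) d≺d′
    where
    pd : P d
    pd = from (closed d∈b dd μd) (proj₂ (kept⁻ e∈))

  empty : ∀ d → d ∈ filter P? b → IsDeq d → μ d ≡ nothing →
          ∀ xs′ ys′ → filter P? b ≡ xs′ ++ d ∷ ys′ → Balanced μ xs′
  empty d d∈ dd μd xs′ ys′ eq with xs , ys , b≡ , refl , _ ← filter-split P? b eq =
    balanced xs b≡ (w-empty d (kept d∈) dd μd xs ys b≡)

remove-unmatched-witness : ∀ {b μ r} → SeqWitness b μ → r ∈ b → IsDeq r → val r ≡ nothing →
                           SeqWitness (remove r b) μ
remove-unmatched-witness {b} {μ} {r} W r∈b r-deq r-null =
  subst (λ b′ → SeqWitness b′ μ) (sym (remove≡filter r b))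
    (filter-witness (_≢? r) W closed
      (λ xs _ → subst (Balanced μ) (remove≡filter r xs) ∘ Balanced-remove-unmatched xs r-deq μr≡nothing))
  where
  open SeqWitness W
  μr≡nothing : μ r ≡ nothing
  μr≡nothing = w-⇒null r r∈b r-deq r-null

  closed : ∀ {d e} → d ∈ b → IsDeq d → μ d ≡ just e → d ≢ r ⇔ e ≢ r
  closed d∈ dd μd = mk⇔ (λ _ → enq≢deq (proj₂ (codom _ _ d∈ dd μd)) r-deq)
                        (λ _ d≡r → case trans (sym μd) (trans (cong μ d≡r) μr≡nothing) of λ ())

remove-matched-pair-witness : ∀ {b μ d e} → Unique b → SeqWitness b μ → d ∈ b → IsDeq d → IsEnq e →
                              μ d ≡ just e → SeqWitness (remove e (remove d b)) μ
remove-matched-pair-witness {b} {μ} {d} {e} u W d∈b d-deq e-enq μd =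
  subst (λ b′ → SeqWitness b′ μ) (sym (remove-remove≡filter d e b))
    (filter-witness ((_≢? d) ∩? (_≢? e)) W closed balanced)
  where
  open SeqWitness W

  closed : ∀ {d′ e′} → d′ ∈ b → IsDeq d′ → μ d′ ≡ just e′ → (d′ ≢ d × d′ ≢ e) ⇔ (e′ ≢ d × e′ ≢ e)
  closed d′∈ d′-deq μd′ = mk⇔
    (λ (d′≢d , _) → enq≢deq e′-enq d-deq ,
                    λ e′≡e → d′≢d (w-inj _ _ _ d′∈ d′-deq d∈b d-deq (trans μd′ (cong just e′≡e)) μd))
    (λ (_ , e′≢e) → (λ d′≡d → e′≢e (just-injective (trans (sym μd′) (trans (cong μ d′≡d) μd)))) ,
                    ≢-sym (enq≢deq e-enq d′-deq))
    where
    e′-enq : IsEnq _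
    e′-enq = proj₂ (codom _ _ d′∈ d′-deq μd′)

  balanced : ∀ xs {ys} → b ≡ xs ++ ys → Balanced μ xs → Balanced μ (filter ((_≢? d) ∩? (_≢? e)) xs)
  balanced xs b≡ bal = subst (Balanced μ) (remove-remove≡filter d e xs) (cases (d ∈? xs) (e ∈? xs))
    where
    cases : Dec (d ∈ xs) → Dec (e ∈ xs) → Balanced μ (remove e (remove d xs))
    cases (yes d∈xs) _ = Balanced-remove-pair xs (Unique-++⁻ˡ xs (subst Unique b≡ u)) d∈xs
      (≺-prefix xs u b≡ (w-order d e d∈b d-deq μd) d∈xs) d-deq e-enq μd bal
    cases (no d∉xs) (no e∉xs) =
      subst (Balanced μ) (sym (trans (cong (remove e) (remove-∉ xs d∉xs)) (remove-∉ xs e∉xs))) bal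
    cases (no d∉xs) (yes e∈xs) = ⊥-elim (<-irrefl (sym bal)
      (unmatched-enqueue-deficit u W xs b≡ e∈xs e-enq
        (λ d′∈ d′-deq μd′ → d∉xs (subst (_∈ xs) (w-inj _ _ _ (∈-prefix b≡ d′∈) d′-deq d∈b d-deq μd′ μd) d′∈))))

lemma3p7 : (b : Behavior) (μ : Event → Maybe Event) →
           WellFormed b → SeqWitness b μ →
           ((d e : Event) → d ∈ b → IsDeq d → e ∈ b → IsEnq e → μ d ≡ just e →
              SeqWitness (remove e (remove d b)) μ)
           × ((d : Event) → d ∈ b → IsDeq d → val d ≡ nothing →
              SeqWitness (remove d b) μ)
lemma3p7 b μ wf W =
  (λ d e d∈b d-deq _ e-enq μd → remove-matched-pair-witness (UP.map⁻ wf) W d∈b d-deq e-enq μd) ,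
  (λ d d∈b d-deq d-null → remove-unmatched-witness W d∈b d-deq d-null)
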